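{- Let $d\ge 8$ be an even integer and $w:=d/2+2$. Let $G$ be a graph containing a bubble gadget $B$ as an induced subgraph, properly attached to $S$ in $G$. Let $H$ be a $(d+1)$-diverse induced subgraph of $G$ such that at least one vertex of the top row of $B$, or at least two vertices of the rightmost column of $B$, have no neighbor in $V(H)\setminus V(B)$. Then $H$ contains at most one vertex of $B$.
   Context: The $w\times w$ rook graph has vertex set $\{(i,j): i,j\in[w]\}$ with $(i,j)$ adjacent to $(k,\ell)\neq(i,j)$ iff $i=k$ or $j=\ell$; $i$ is the row (row 1 is the top) and $j$ the column (column $w$ is rightmost). A bubble gadget is the $w\times w$ rook graph minus the two vertices $(1,w-1),(1,w)$. Its top row is $\{(1,j): j\in[w-2]\}$ (of size $d/2$) and its rightmost column is $\{(i,w): 2\le i\le w\}$ (of size $d/2+1$). If $B$ is an induced subgraph of $G$ that is a bubble gadget, let $S$ be the set of vertices outside $V(B)$ having a neighbor in $V(B)$; $B$ is properly attached to $S$ in $G$ if every vertex of the top row and of the rightmost column has one or two neighbors outside $V(B)$, while all other vertices of $B$ have no neighbor outside $V(B)$. Two distinct vertices $u,v$ of a graph $H$ are $d$-twins if $|(N_H(u)\setminus N_H[v])\cup(N_H(v)\setminus N_H[u])|\le d$. A graph is $(d+1)$-diverse if it has at least two vertices and no pair of $d$-twins. -}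

module Defs where

open import Data.Bool using (Bool; true; false; _∧_; _∨_; not; T)
open import Data.Nat using (ℕ; zero; suc; _+_; _*_; _∸_; _≤_; _<_)
import Data.Nat as ℕ
open import Data.Fin using (Fin; toℕ)
import Data.Fin as Fin
open import Data.Product using (_×_; _,_; proj₁; proj₂; Σ; ∃)
open import Data.Sum using (_⊎_)
open import Data.List using (List; allFin; cartesianProduct; length; filter)
open import Data.Bool.ListAction using (any)
import Data.List as List
open import Relation.Nullary using (¬_; does)
open import Data.Bool.Properties using (T?)
open import Relation.Binary.PropositionalEquality using (_≡_; _≢_)

count : ∀ {n} → (Fin n → Bool) → ℕ
count {n} P = length (List.filter (λ x → T? (P x)) (allFin n))

record Graph (n : ℕ) : Set where
  field
    adj    : Fin n → Fin n → Bool
    sym    : ∀ x y → adj x y ≡ adj y x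
    irrefl : ∀ x → adj x x ≡ false
open Graph public

-- Vertices of the w×w rook graph: (i , j), i = row (0 = top row, i.e. row 1),
-- j = column (w-1 = rightmost column, i.e. column w).
RookV : ℕ → Set
RookV w = Fin w × Fin w

_=ᶠ_ : ∀ {w} → Fin w → Fin w → Bool
i =ᶠ k = does (i Fin.≟ k)

rookAdj : ∀ {w} → RookV w → RookV w → Bool
rookAdj (i , j) (k , l) = not ((i =ᶠ k) ∧ (j =ᶠ l)) ∧ ((i =ᶠ k) ∨ (j =ᶠ l))

-- Vertices of the bubble gadget: all rook vertices except (row 1, column w-1)
-- and (row 1, column w), i.e. except (0 , w-2) and (0 , w-1) in 0-indexing.
isBubble : ∀ w → RookV w → Bool
isBubble w (i , j) = not ((toℕ i ℕ.≡ᵇ 0) ∧ ((w ∸ 2) ℕ.≤ᵇ toℕ j))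

isTopRow : ∀ w → RookV w → Bool
isTopRow w (i , j) = (toℕ i ℕ.≡ᵇ 0) ∧ (suc (toℕ j) ℕ.≤ᵇ (w ∸ 2))

isRightCol : ∀ w → RookV w → Bool
isRightCol w (i , j) = not (toℕ i ℕ.≡ᵇ 0) ∧ (toℕ j ℕ.≡ᵇ (w ∸ 1))

record BubbleIn {n : ℕ} (G : Graph n) (w : ℕ) : Set where
  field
    emb     : RookV w → Fin n
    inj     : ∀ p q → T (isBubble w p) → T (isBubble w q) → emb p ≡ emb q → p ≡ q
    induced : ∀ p q → T (isBubble w p) → T (isBubble w q) →
              adj G (emb p) (emb q) ≡ rookAdj p q
open BubbleIn public

inVB : ∀ {n} {G : Graph n} {w} → BubbleIn G w → Fin n → Bool
inVB {n} {G} {w} B x =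
  any (λ p → isBubble w p ∧ does (emb B p Fin.≟ x)) (cartesianProduct (allFin w) (allFin w))

outDeg : ∀ {n} {G : Graph n} {w} → BubbleIn G w → RookV w → ℕ
outDeg {G = G} B p = count (λ x → adj G (emb B p) x ∧ not (inVB B x))

-- B is properly attached (to S = set of outside vertices with a neighbour in V(B)).
ProperlyAttached : ∀ {n} {G : Graph n} {w} → BubbleIn G w → Set
ProperlyAttached {w = w} B =
  ∀ p → T (isBubble w p) →
    (T (isTopRow w p ∨ isRightCol w p) → 1 ≤ outDeg B p × outDeg B p ≤ 2) ×
    (T (not (isTopRow w p ∨ isRightCol w p)) → outDeg B p ≡ 0)

-- Induced subgraph H of G given by its vertex set U.
-- Size of the symmetric difference (N_H(u) \ N_H[v]) ∪ (N_H(v) \ N_H[u]).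
twinDist : ∀ {n} (G : Graph n) (U : Fin n → Bool) → Fin n → Fin n → ℕ
twinDist G U u v = count (λ x → U x ∧
  ((adj G u x ∧ not (adj G v x) ∧ not (does (x Fin.≟ v))) ∨
   (adj G v x ∧ not (adj G u x) ∧ not (does (x Fin.≟ u)))))

Twins : ∀ {n} (G : Graph n) (U : Fin n → Bool) (d : ℕ) → Fin n → Fin n → Set
Twins G U d u v = T (U u) × T (U v) × u ≢ v × twinDist G U u v ≤ d

-- H = G[U] is (d+1)-diverse.
Diverse : ∀ {n} (G : Graph n) (U : Fin n → Bool) (d : ℕ) → Set
Diverse G U d = 2 ≤ count U × (∀ u v → ¬ Twins G U d u v)

NoOutsideNbrInH : ∀ {n} {G : Graph n} {w} → BubbleIn G w → (Fin n → Bool) → RookV w → Set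
NoOutsideNbrInH {G = G} B U p = ∀ x → T (U x) → T (not (inVB B x)) → adj G (emb B p) x ≡ false

-- Two distinct vertices u, v of H are d-twins as soon as few vertices of H
-- distinguish them.  Inside B such a vertex is a rook-neighbour of u not adjacent
-- to v (or vice versa); when u and v share a line it lies on the other line
-- through u, and proper attachment leaves each vertex of B at most two neighbours
-- outside B.  So if H met B twice, counting along lines would force in turn: two
-- vertices of H in one column below the top row and left of column w; a row with
-- vertices of H in column w - 1 and in a column of the top row; all of column
-- w - 1 below the top row in H.  Against that column, the vertex (or pair of
-- vertices) without neighbours in V(H) outside B given by the hypothesis yields
-- a pair of d-twins.

module Submission where

open import Data.Bool using (Bool; true; false; T; not; _∧_; _∨_; if_then_else_)
open import Data.Bool.Properties using (T?; T-∧)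
open import Data.Empty using (⊥; ⊥-elim)
open import Data.Fin using (Fin; zero; suc; toℕ; inject₁; fromℕ; fromℕ<)
import Data.Fin.Properties as Fin
open import Data.List using (List; []; _∷_; length; map; filter; tabulate; allFin; cartesianProduct)
open import Data.List.Membership.Propositional using (_∈_; _∉_)
open import Data.List.Membership.Propositional.Properties using (∈-map⁺; ∈-filter⁺; ∈-allFin)
open import Data.List.Properties using (length-map)
open import Data.List.Relation.Unary.All using (All; []; _∷_)
open import Data.List.Relation.Unary.All.Properties using (All¬⇒¬Any)
open import Data.List.Relation.Unary.Any using (here; there; any?; satisfied)
open import Data.List.Relation.Unary.Any.Properties using (any⁻)
open import Data.List.Relation.Unary.Unique.Propositional using (Unique; []; _∷_)
open import Data.Nat using (ℕ; zero; suc; _+_; _*_; _∸_; _≤_; _<_; z≤n; s≤s; s≤s⁻¹)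
import Data.Nat as ℕ
open import Data.Nat.Properties
open import Data.Product using (_×_; _,_; proj₁; proj₂; ∃; ∃₂)
open import Data.Sum using (_⊎_; inj₁; inj₂; [_,_]′)
open import Function using (_∘_; Equivalence)
open import Relation.Nullary using (¬_; Dec; yes; no; does; _because_)
open import Relation.Nullary.Reflects using (invert)
open import Relation.Nullary.Decidable using (isYes; True; toWitness; fromWitness; ¬?; _×-dec_)
open import Relation.Binary.PropositionalEquality

open import Defs hiding (sym)

T-∧⁻ : ∀ a {b} → T (a ∧ b) → T a × T b
T-∧⁻ _ = Equivalence.to T-∧

T-does⇒ : ∀ {A : Set} (a? : Dec A) → T (does a?) → A
T-does⇒ (true because [a]) _ = invert [a]

T-not-does⇒ : ∀ {A : Set} (a? : Dec A) → T (not (does a?)) → ¬ A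
T-not-does⇒ (false because [¬a]) _ = invert [¬a]

T-not⇒¬T : ∀ {b} → T (not b) → ¬ T b
T-not⇒¬T {false} _ ()

¬T⇒T-not : ∀ {b} → ¬ T b → T (not b)
¬T⇒T-not {true}  ¬b = ¬b _
¬T⇒T-not {false} _  = _

T-∧-∨-split : ∀ a b c → T (a ∧ (b ∨ c)) → T (a ∧ b) ⊎ T (a ∧ c)
T-∧-∨-split true true  _ _ = inj₁ _
T-∧-∨-split true false _ h = inj₂ h

T-∧-split-by : ∀ a b c d → T (a ∧ c ∧ d) → T (a ∧ b ∧ c ∧ d) ⊎ T (a ∧ c ∧ not b)
T-∧-split-by true true  _    _ h = inj₁ h
T-∧-split-by true false true _ _ = inj₂ _

∣_∣ : ∀ {n} → (Fin n → Bool) → ℕ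
∣_∣ {zero}  P = 0
∣_∣ {suc n} P = if P zero then suc ∣ P ∘ suc ∣ else ∣ P ∘ suc ∣

_⊆ᵇ_ : ∀ {n} → (Fin n → Bool) → (Fin n → Bool) → Set
P ⊆ᵇ Q = ∀ x → T (P x) → T (Q x)

_∈ᵇ_ : ∀ {n} → Fin n → List (Fin n) → Bool
x ∈ᵇ xs = isYes (any? (x Fin.≟_) xs)

length-filter-tabulate : ∀ {m n} (P : Fin n → Bool) (g : Fin m → Fin n) →
                         length (filter (T? ∘ P) (tabulate g)) ≡ ∣ P ∘ g ∣
length-filter-tabulate {zero}  P g = refl
length-filter-tabulate {suc m} P g with P (g zero)
... | true  = cong suc (length-filter-tabulate P (g ∘ suc))
... | false = length-filter-tabulate P (g ∘ suc)

count≡∣∣ : ∀ {n} (P : Fin n → Bool) → count P ≡ ∣ P ∣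
count≡∣∣ P = length-filter-tabulate P (λ x → x)

∣∣-mono : ∀ {n} {P Q : Fin n → Bool} → P ⊆ᵇ Q → ∣ P ∣ ≤ ∣ Q ∣
∣∣-mono {zero} P⊆Q = z≤n
∣∣-mono {suc n} {P} {Q} P⊆Q with P zero | Q zero | P⊆Q zero
... | true  | true  | _ = s≤s (∣∣-mono (P⊆Q ∘ suc))
... | true  | false | h = ⊥-elim (h _)
... | false | true  | _ = m≤n⇒m≤1+n (∣∣-mono (P⊆Q ∘ suc))
... | false | false | _ = ∣∣-mono (P⊆Q ∘ suc)

∣∘suc∣≤∣∣ : ∀ {n} (P : Fin (suc n) → Bool) → ∣ P ∘ suc ∣ ≤ ∣ P ∣
∣∘suc∣≤∣∣ P with P zero
... | true  = n≤1+n _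
... | false = ≤-refl

∣∣≤∣∣+∣∣ : ∀ {n} {P Q R : Fin n → Bool} → (∀ x → T (P x) → T (Q x) ⊎ T (R x)) →
           ∣ P ∣ ≤ ∣ Q ∣ + ∣ R ∣
∣∣≤∣∣+∣∣ {zero} split = z≤n
∣∣≤∣∣+∣∣ {suc n} {P} {Q} {R} split with P zero | split zero
... | false | _ = ≤-trans (∣∣≤∣∣+∣∣ (split ∘ suc)) (+-mono-≤ (∣∘suc∣≤∣∣ Q) (∣∘suc∣≤∣∣ R))
... | true  | h with Q zero | R zero | h _
...   | true  | false | _ = s≤s (∣∣≤∣∣+∣∣ (split ∘ suc))
...   | true  | true  | _ = s≤s (≤-trans (∣∣≤∣∣+∣∣ (split ∘ suc)) (+-monoʳ-≤ ∣ Q ∘ suc ∣ (n≤1+n _)))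
...   | false | true  | _ =
  subst (suc ∣ P ∘ suc ∣ ≤_) (sym (+-suc ∣ Q ∘ suc ∣ ∣ R ∘ suc ∣)) (s≤s (∣∣≤∣∣+∣∣ (split ∘ suc)))
...   | false | false | inj₁ ()
...   | false | false | inj₂ ()

∣∣+∣∣≤∣∣ : ∀ {n} {P Q R : Fin n → Bool} → (∀ x → T (P x) → ¬ T (Q x)) →
           (∀ x → T (P x) ⊎ T (Q x) → T (R x)) → ∣ P ∣ + ∣ Q ∣ ≤ ∣ R ∣
∣∣+∣∣≤∣∣ {zero} disjoint cover = z≤n
∣∣+∣∣≤∣∣ {suc n} {P} {Q} {R} disjoint cover
  with P zero | Q zero | R zero | disjoint zero | cover zero
... | true  | true  | _     | d | _ = ⊥-elim (d _ _)
... | true  | false | false | _ | c = ⊥-elim (c (inj₁ _))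
... | false | true  | false | _ | c = ⊥-elim (c (inj₂ _))
... | true  | false | true  | _ | _ = s≤s (∣∣+∣∣≤∣∣ (disjoint ∘ suc) (cover ∘ suc))
... | false | true  | true  | _ | _ =
  subst (_≤ suc ∣ R ∘ suc ∣) (sym (+-suc ∣ P ∘ suc ∣ ∣ Q ∘ suc ∣))
        (s≤s (∣∣+∣∣≤∣∣ (disjoint ∘ suc) (cover ∘ suc)))
... | false | false | true  | _ | _ = m≤n⇒m≤1+n (∣∣+∣∣≤∣∣ (disjoint ∘ suc) (cover ∘ suc))
... | false | false | false | _ | _ = ∣∣+∣∣≤∣∣ (disjoint ∘ suc) (cover ∘ suc)

∣∣≡0 : ∀ {n} {P : Fin n → Bool} → (∀ x → ¬ T (P x)) → ∣ P ∣ ≡ 0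
∣∣≡0 {zero} none = refl
∣∣≡0 {suc n} {P} none with P zero | none zero
... | true  | h = ⊥-elim (h _)
... | false | _ = ∣∣≡0 (none ∘ suc)

∣∣>0 : ∀ {n} {P : Fin n → Bool} x → T (P x) → 0 < ∣ P ∣
∣∣>0 {P = P} zero Px with P zero
... | true = s≤s z≤n
∣∣>0 {P = P} (suc x) Px with P zero
... | true  = s≤s z≤n
... | false = ∣∣>0 x Px

∣∣≤1 : ∀ {n} {P : Fin n → Bool} → (∀ x y → T (P x) → T (P y) → x ≡ y) → ∣ P ∣ ≤ 1
∣∣≤1 {zero} unique = z≤n
∣∣≤1 {suc n} {P} unique with P zero in P0
... | true  = ≤-reflexive (cong suc (∣∣≡0 λ x Px → Fin.0≢1+n (unique zero (suc x) (subst T (sym P0) _) Px)))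
... | false = ∣∣≤1 λ x y Px Py → Fin.suc-injective (unique (suc x) (suc y) Px Py)

∣true∣ : ∀ n → ∣ (λ (_ : Fin n) → true) ∣ ≡ n
∣true∣ zero    = refl
∣true∣ (suc n) = cong suc (∣true∣ n)

∣∈ᵇ∣≤length : ∀ {n} (xs : List (Fin n)) → ∣ (_∈ᵇ xs) ∣ ≤ length xs
∣∈ᵇ∣≤length {n} [] = ≤-reflexive (∣∣≡0 {n} {_∈ᵇ []} λ _ ())
∣∈ᵇ∣≤length (y ∷ ys) =
  ≤-trans (∣∣≤∣∣+∣∣ split) (+-mono-≤ (∣∣≤1 {P = λ x → isYes (x Fin.≟ y)} same) (∣∈ᵇ∣≤length ys))
  where
  same : ∀ x z → True (x Fin.≟ y) → True (z Fin.≟ y) → x ≡ z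
  same x z x≡y z≡y = trans (toWitness x≡y) (sym (toWitness z≡y))
  split : ∀ x → T (x ∈ᵇ (y ∷ ys)) → True (x Fin.≟ y) ⊎ T (x ∈ᵇ ys)
  split x x∈ with toWitness x∈
  ... | here x≡y   = inj₁ (fromWitness x≡y)
  ... | there x∈ys = inj₂ (fromWitness x∈ys)

length≤∣∈ᵇ∣ : ∀ {n} {xs : List (Fin n)} → Unique xs → length xs ≤ ∣ (_∈ᵇ xs) ∣
length≤∣∈ᵇ∣ [] = z≤n
length≤∣∈ᵇ∣ {xs = y ∷ ys} (y∉ys ∷ unique) =
  ≤-trans (+-mono-≤ (∣∣>0 y (fromWitness refl)) (length≤∣∈ᵇ∣ unique)) (∣∣+∣∣≤∣∣ disjoint cover)
  where
  disjoint : ∀ x → True (x Fin.≟ y) → ¬ T (x ∈ᵇ ys)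
  disjoint x x≡y x∈ys = All¬⇒¬Any y∉ys (subst (_∈ ys) (toWitness x≡y) (toWitness x∈ys))
  cover : ∀ x → True (x Fin.≟ y) ⊎ T (x ∈ᵇ ys) → T (x ∈ᵇ (y ∷ ys))
  cover x (inj₁ x≡y)  = fromWitness (here (toWitness x≡y))
  cover x (inj₂ x∈ys) = fromWitness (there (toWitness x∈ys))

∣∣≤length : ∀ {n} {P : Fin n → Bool} (xs : List (Fin n)) → (∀ x → T (P x) → x ∈ xs) → ∣ P ∣ ≤ length xs
∣∣≤length xs ⊆xs = ≤-trans (∣∣-mono (λ x Px → fromWitness (⊆xs x Px))) (∣∈ᵇ∣≤length xs)

∣∣≤∣∘∣ : ∀ {m n} {P : Fin n → Bool} (f : Fin m → Fin n) → (∀ x → T (P x) → ∃ λ t → f t ≡ x) →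
         ∣ P ∣ ≤ ∣ P ∘ f ∣
∣∣≤∣∘∣ {m} {P = P} f onto = begin
  ∣ P ∣              ≤⟨ ∣∣≤length (map f ts) covered ⟩
  length (map f ts)  ≡⟨ length-map f ts ⟩
  length ts          ≡⟨ length-filter-tabulate (P ∘ f) (λ t → t) ⟩
  ∣ P ∘ f ∣          ∎
  where
  open ≤-Reasoning
  ts = filter (T? ∘ P ∘ f) (allFin m)
  covered : ∀ x → T (P x) → x ∈ map f ts
  covered x Px with onto x Px
  ... | t , refl = ∈-map⁺ f (∈-filter⁺ (T? ∘ P ∘ f) (∈-allFin t) Px)

∣∣≤∸length : ∀ {m} {Q : Fin m → Bool} (excl : List (Fin m)) → Unique excl →
             (∀ t → T (Q t) → t ∉ excl) → ∣ Q ∣ ≤ m ∸ length excl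
∣∣≤∸length {m} {Q} excl unique avoid = m+n≤o⇒m≤o∸n ∣ Q ∣ (begin
  ∣ Q ∣ + length excl          ≤⟨ +-monoʳ-≤ ∣ Q ∣ (length≤∣∈ᵇ∣ unique) ⟩
  ∣ Q ∣ + ∣ (_∈ᵇ excl) ∣       ≤⟨ ∣∣+∣∣≤∣∣ (λ t Qt t∈ → avoid t Qt (toWitness t∈)) (λ _ _ → _) ⟩
  ∣ (λ (_ : Fin m) → true) ∣   ≡⟨ ∣true∣ m ⟩
  m                            ∎)
  where open ≤-Reasoning

module _ {w : ℕ} {i j k l : Fin w} where

  rookAdj⇒sameRow⊎sameCol : T (rookAdj (i , j) (k , l)) → (i ≡ k × j ≢ l) ⊎ (j ≡ l × i ≢ k)
  rookAdj⇒sameRow⊎sameCol adj with i Fin.≟ k | j Fin.≟ l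
  ... | yes i≡k | no  j≢l = inj₁ (i≡k , j≢l)
  ... | no  i≢k | yes j≡l = inj₂ (j≡l , i≢k)

  rookAdj-sameRow : i ≡ k → j ≢ l → T (rookAdj (i , j) (k , l))
  rookAdj-sameRow i≡k j≢l with i Fin.≟ k | j Fin.≟ l
  ... | yes _   | no _    = _
  ... | yes _   | yes j≡l = ⊥-elim (j≢l j≡l)
  ... | no  i≢k | _       = ⊥-elim (i≢k i≡k)

  rookAdj-sameCol : j ≡ l → i ≢ k → T (rookAdj (i , j) (k , l))
  rookAdj-sameCol j≡l i≢k with i Fin.≟ k | j Fin.≟ l
  ... | no _    | yes _   = _
  ... | yes i≡k | _       = ⊥-elim (i≢k i≡k)
  ... | no  _   | no  j≢l = ⊥-elim (j≢l j≡l)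

module InducedBubble {n w : ℕ} {G : Graph n} (B : BubbleIn G w) (U : Fin n → Bool) where

  Bub : RookV w → Set
  Bub r = T (isBubble w r)

  InH : RookV w → Set
  InH r = T (U (emb B r))

  inVB⇒emb : ∀ {x} → T (inVB B x) → ∃ λ r → Bub r × emb B r ≡ x
  inVB⇒emb {x} x∈B with satisfied (any⁻ _ (cartesianProduct (allFin w) (allFin w)) x∈B)
  ... | r , h with T-∧⁻ (isBubble w r) h
  ...   | bub , r↦x = r , bub , T-does⇒ (emb B r Fin.≟ x) r↦x

  record PrivateNbr (u v r : RookV w) : Set where
    field
      bubble : Bub r
      inH    : InH r
      adj-u  : T (rookAdj u r)
      ¬adj-v : ¬ T (rookAdj v r)
      ≢v     : r ≢ v

  open PrivateNbr public

  InH-≢ : ∀ {r s} → InH r → ¬ InH s → r ≢ s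
  InH-≢ Hr ¬Hs refl = ¬Hs Hr

  privateNbr-sameRow : ∀ {i j l ρ c} → j ≢ l → PrivateNbr (i , j) (i , l) (ρ , c) → c ≡ j × ρ ≢ i
  privateNbr-sameRow {i} {l = l} {c = c} j≢l nbr with rookAdj⇒sameRow⊎sameCol (adj-u nbr)
  ... | inj₂ (j≡c , i≢ρ) = sym j≡c , i≢ρ ∘ sym
  ... | inj₁ (refl , _) with c Fin.≟ l
  ...   | yes refl = ⊥-elim (≢v nbr refl)
  ...   | no  c≢l  = ⊥-elim (¬adj-v nbr (rookAdj-sameRow {i = i} {j = l} refl (c≢l ∘ sym)))

  privateNbr-sameCol : ∀ {i k j ρ c} → i ≢ k → PrivateNbr (i , j) (k , j) (ρ , c) → ρ ≡ i × c ≢ j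
  privateNbr-sameCol {k = k} {j} {ρ} i≢k nbr with rookAdj⇒sameRow⊎sameCol (adj-u nbr)
  ... | inj₁ (i≡ρ , j≢c) = sym i≡ρ , j≢c ∘ sym
  ... | inj₂ (refl , _) with ρ Fin.≟ k
  ...   | yes refl = ⊥-elim (≢v nbr refl)
  ...   | no  ρ≢k  = ⊥-elim (¬adj-v nbr (rookAdj-sameCol {i = k} {j = j} refl (ρ≢k ∘ sym)))

  distinguishes : RookV w → RookV w → Fin n → Bool
  distinguishes u v x = adj G (emb B u) x ∧ not (adj G (emb B v) x) ∧ not (does (x Fin.≟ emb B v))

  privateIn : RookV w → RookV w → Fin n → Bool
  privateIn u v x = U x ∧ inVB B x ∧ distinguishes u v x

  outside : RookV w → Fin n → Bool
  outside u x = U x ∧ adj G (emb B u) x ∧ not (inVB B x)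

  privateIn⇒PrivateNbr : ∀ {u v} → Bub u → Bub v → ∀ x → T (privateIn u v x) →
                         ∃ λ r → PrivateNbr u v r × emb B r ≡ x
  privateIn⇒PrivateNbr {u} {v} bu bv x h with T-∧⁻ (U x) h
  ... | Hx , h₁ with T-∧⁻ (inVB B x) h₁
  ... | x∈B , h₂ with inVB⇒emb {x} x∈B
  ... | r , br , refl with T-∧⁻ (adj G (emb B u) (emb B r)) h₂
  ... | adjU , h₃ with T-∧⁻ (not (adj G (emb B v) (emb B r))) h₃
  ... | ¬adjV , r≢v = r , nbr , refl
    where
    nbr : PrivateNbr u v r
    nbr = record
      { bubble = br
      ; inH    = Hx
      ; adj-u  = subst T (induced B u r bu br) adjU
      ; ¬adj-v = T-not⇒¬T ¬adjV ∘ subst T (sym (induced B v r bv br))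
      ; ≢v     = T-not-does⇒ (emb B r Fin.≟ emb B v) r≢v ∘ cong (emb B)
      }

  twinDist≤ : ∀ u v → twinDist G U (emb B u) (emb B v) ≤
              (∣ privateIn u v ∣ + ∣ outside u ∣) + (∣ privateIn v u ∣ + ∣ outside v ∣)
  twinDist≤ u v = begin
    twinDist G U (emb B u) (emb B v)                          ≡⟨ count≡∣∣ (λ x → U x ∧ (D u v x ∨ D v u x)) ⟩
    ∣ (λ x → U x ∧ (D u v x ∨ D v u x)) ∣                     ≤⟨ ∣∣≤∣∣+∣∣ (λ x → T-∧-∨-split (U x) _ _) ⟩
    ∣ (λ x → U x ∧ D u v x) ∣ + ∣ (λ x → U x ∧ D v u x) ∣     ≤⟨ +-mono-≤ (side u v) (side v u) ⟩
    (∣ privateIn u v ∣ + ∣ outside u ∣) + (∣ privateIn v u ∣ + ∣ outside v ∣) ∎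
    where
    open ≤-Reasoning
    D = distinguishes
    side : ∀ u v → ∣ (λ x → U x ∧ D u v x) ∣ ≤ ∣ privateIn u v ∣ + ∣ outside u ∣
    side u v = ∣∣≤∣∣+∣∣ λ x → T-∧-split-by (U x) (inVB B x) (adj G (emb B u) x) _

  bounded⇒twins : ∀ {d} u v → Bub u → Bub v → u ≢ v → InH u → InH v → ∀ {p q s t} →
                  ∣ privateIn u v ∣ ≤ p → ∣ outside u ∣ ≤ q → ∣ privateIn v u ∣ ≤ s → ∣ outside v ∣ ≤ t →
                  (p + q) + (s + t) ≤ d → Twins G U d (emb B u) (emb B v)
  bounded⇒twins u v bu bv u≢v Hu Hv ≤p ≤q ≤s ≤t ≤d =
    Hu , Hv , u≢v ∘ inj B u v bu bv ,
    ≤-trans (twinDist≤ u v) (≤-trans (+-mono-≤ (+-mono-≤ ≤p ≤q) (+-mono-≤ ≤s ≤t)) ≤d)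

  module _ {u v : RookV w} (bu : Bub u) (bv : Bub v) where

    privateIn-none : (∀ {r} → ¬ PrivateNbr u v r) → ∣ privateIn u v ∣ ≤ 0
    privateIn-none none = ≤-reflexive (∣∣≡0 λ x Px → none (proj₁ (proj₂ (privateIn⇒PrivateNbr bu bv x Px))))

    privateIn-unique : (∀ {r s} → PrivateNbr u v r → PrivateNbr u v s → r ≡ s) → ∣ privateIn u v ∣ ≤ 1
    privateIn-unique unique = ∣∣≤1 λ x y Px Py →
      let r , nbr-r , r↦x = privateIn⇒PrivateNbr bu bv x Px
          s , nbr-s , s↦y = privateIn⇒PrivateNbr bu bv y Py
      in trans (sym r↦x) (trans (cong (emb B) (unique nbr-r nbr-s)) s↦y)

    privateIn-line : ∀ {m} (ℓ : Fin m → RookV w) → (∀ t → Bub (ℓ t)) → (excl : List (Fin m)) → Unique excl →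
                     (∀ {r} → PrivateNbr u v r → ∃ λ t → ℓ t ≡ r) →
                     (∀ {t} → PrivateNbr u v (ℓ t) → All (t ≢_) excl) →
                     ∣ privateIn u v ∣ ≤ m ∸ length excl
    privateIn-line ℓ bubble-ℓ excl unique on-ℓ avoid =
      ≤-trans (∣∣≤∣∘∣ (emb B ∘ ℓ) onto) (∣∣≤∸length excl unique avoid′)
      where
      onto : ∀ x → T (privateIn u v x) → ∃ λ t → emb B (ℓ t) ≡ x
      onto x Px with privateIn⇒PrivateNbr bu bv x Px
      ... | r , nbr , r↦x with on-ℓ nbr
      ...   | t , refl = t , r↦x
      avoid′ : ∀ t → T (privateIn u v (emb B (ℓ t))) → t ∉ excl
      avoid′ t Pt with privateIn⇒PrivateNbr bu bv _ Pt
      ... | r , nbr , r↦ℓt with inj B r (ℓ t) (bubble nbr) (bubble-ℓ t) r↦ℓt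
      ...   | refl = All¬⇒¬Any (avoid nbr)

  ∣outside∣≤outDeg : ∀ u → ∣ outside u ∣ ≤ outDeg B u
  ∣outside∣≤outDeg u = ≤-trans (∣∣-mono λ x h → proj₂ (T-∧⁻ (U x) h))
                               (≤-reflexive (sym (count≡∣∣ λ x → adj G (emb B u) x ∧ not (inVB B x))))

  ∣outside∣-free : ∀ {u} → NoOutsideNbrInH B U u → ∣ outside u ∣ ≤ 0
  ∣outside∣-free {u} free = ≤-reflexive (∣∣≡0 λ x h →
    let Hx , h′ = T-∧⁻ (U x) h
        adj-x , x∉B = T-∧⁻ (adj G (emb B u) x) h′
    in subst T (free x Hx x∉B) adj-x)

  module _ (attached : ProperlyAttached B) where

    ∣outside∣-interior : ∀ {u} → Bub u → T (not (isTopRow w u ∨ isRightCol w u)) → ∣ outside u ∣ ≤ 0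
    ∣outside∣-interior {u} bu interior =
      ≤-trans (∣outside∣≤outDeg u) (≤-reflexive (proj₂ (attached u bu) interior))

    ∣outside∣≤2 : ∀ {u} → Bub u → ∣ outside u ∣ ≤ 2
    ∣outside∣≤2 {u} bu with isTopRow w u ∨ isRightCol w u in boundary
    ... | true  = ≤-trans (∣outside∣≤outDeg u) (proj₂ (proj₁ (attached u bu) (subst T (sym boundary) _)))
    ... | false = ≤-trans (∣outside∣-interior bu (subst (T ∘ not) (sym boundary) _)) z≤n

module DiverseBubble {k : ℕ} (4≤k : 4 ≤ k) {n : ℕ} {G : Graph n} (B : BubbleIn G (suc (suc k)))
  (attached : ProperlyAttached B) (U : Fin n → Bool) (noTwins : ∀ {x y} → ¬ Twins G U (2 * k) x y) where

  open InducedBubble B U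

  W : ℕ
  W = suc (suc k)

  -- Rows and columns are 0-indexed: row zero is the top row and suc i ranges over the
  -- rows below it; Inner columns are those of the top row, and penult, right are the
  -- paper's columns w - 1 and w.
  Inner NotRight : Fin W → Set
  Inner j    = toℕ j < k
  NotRight j = toℕ j ≤ k

  penult right : Fin W
  penult = inject₁ (fromℕ k)
  right  = fromℕ (suc k)

  toℕ-penult : toℕ penult ≡ k
  toℕ-penult = trans (Fin.toℕ-inject₁ (fromℕ k)) (Fin.toℕ-fromℕ k)

  toℕ-right : toℕ right ≡ suc k
  toℕ-right = Fin.toℕ-fromℕ (suc k)

  inner-zero : Inner zero
  inner-zero = ≤-trans (s≤s z≤n) 4≤k

  notRight-penult : NotRight penult
  notRight-penult = ≤-reflexive toℕ-penult

  inner⇒notRight : ∀ {j} → Inner j → NotRight j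
  inner⇒notRight = <⇒≤

  inner⇒≢penult : ∀ {j} → Inner j → j ≢ penult
  inner⇒≢penult j<k refl = <⇒≢ j<k toℕ-penult

  notRight⇒≢right : ∀ {j} → NotRight j → j ≢ right
  notRight⇒≢right j≤k refl = 1+n≰n (subst (_≤ k) toℕ-right j≤k)

  penult≢right : penult ≢ right
  penult≢right = notRight⇒≢right notRight-penult

  ≢right⇒notRight : ∀ {j} → j ≢ right → NotRight j
  ≢right⇒notRight {j} j≢right with toℕ j ℕ.≟ suc k
  ... | yes j≡1+k = ⊥-elim (j≢right (Fin.toℕ-injective (trans j≡1+k (sym toℕ-right))))
  ... | no  j≢1+k = s≤s⁻¹ (≤∧≢⇒< (s≤s⁻¹ (Fin.toℕ<n j)) j≢1+k)

  notRight⇒inner⊎penult : ∀ {j} → NotRight j → Inner j ⊎ j ≡ penult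
  notRight⇒inner⊎penult {j} j≤k with toℕ j ℕ.≟ k
  ... | yes j≡k = inj₂ (Fin.toℕ-injective (trans j≡k (sym toℕ-penult)))
  ... | no  j≢k = inj₁ (≤∧≢⇒< j≤k j≢k)

  bubble-top : ∀ {j} → Inner j → Bub (zero , j)
  bubble-top {j} j<k = ¬T⇒T-not λ k≤j → <⇒≱ j<k (≤ᵇ⇒≤ k (toℕ j) k≤j)

  bubble-top⁻¹ : ∀ {j} → Bub (zero , j) → Inner j
  bubble-top⁻¹ {j} bub = ≰⇒> λ k≤j → T-not⇒¬T bub (≤⇒≤ᵇ k≤j)

  bubble-lowerRow : ∀ {ρ c} → ¬ Inner c → Bub (ρ , c) → ∃ λ i → ρ ≡ suc i
  bubble-lowerRow {zero}  ¬inner bub = ⊥-elim (¬inner (bubble-top⁻¹ bub))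
  bubble-lowerRow {suc i} ¬inner bub = i , refl

  interior : ∀ {i j} → NotRight j → T (not (isTopRow W (suc i , j) ∨ isRightCol W (suc i , j)))
  interior j≤k = ¬T⇒T-not λ h →
    notRight⇒≢right j≤k (Fin.toℕ-injective (trans (≡ᵇ⇒≡ _ _ h) (sym toℕ-right)))

  topRow⁻¹ : ∀ {ρ c} → T (isTopRow W (ρ , c)) → ρ ≡ zero × Inner c
  topRow⁻¹ {zero} {c} h = refl , ≤ᵇ⇒≤ (suc (toℕ c)) k h

  rightCol⁻¹ : ∀ {ρ c} → T (isRightCol W (ρ , c)) → ∃ λ i → ρ ≡ suc i × c ≡ right
  rightCol⁻¹ {suc i} h = i , refl , Fin.toℕ-injective (trans (≡ᵇ⇒≡ _ _ h) (sym toℕ-right))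

  ¬inner-penult : ¬ Inner penult
  ¬inner-penult p<k = inner⇒≢penult p<k refl

  ¬inner-right : ¬ Inner right
  ¬inner-right r<k = notRight⇒≢right (inner⇒notRight r<k) refl

  column : Fin W → Fin W → RookV W
  column j t = t , j

  lowerColumn : Fin W → Fin (suc k) → RookV W
  lowerColumn j t = suc t , j

  lowerRow : Fin (suc k) → Fin W → RookV W
  lowerRow i t = suc i , t

  topRow : Fin k → RookV W
  topRow t = zero , inject₁ (inject₁ t)

  toℕ-topRow : ∀ t → toℕ (proj₂ (topRow t)) ≡ toℕ t
  toℕ-topRow t = trans (Fin.toℕ-inject₁ _) (Fin.toℕ-inject₁ t)

  column-bubble : ∀ {j} → Inner j → ∀ t → Bub (column j t)
  column-bubble j<k zero    = bubble-top j<k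
  column-bubble j<k (suc t) = _

  topRow-bubble : ∀ t → Bub (topRow t)
  topRow-bubble t = bubble-top (subst (_< k) (sym (toℕ-topRow t)) (Fin.toℕ<n t))

  onColumn : ∀ {j r} → proj₂ r ≡ j → ∃ λ t → column j t ≡ r
  onColumn {r = ρ , _} refl = ρ , refl

  onLowerRow : ∀ {i r} → proj₁ r ≡ suc i → ∃ λ t → lowerRow i t ≡ r
  onLowerRow {r = _ , c} refl = c , refl

  onLowerColumn : ∀ {j r} → ¬ Inner j → Bub r → proj₂ r ≡ j → ∃ λ t → lowerColumn j t ≡ r
  onLowerColumn {r = ρ , _} ¬inner bub refl with bubble-lowerRow {ρ} ¬inner bub
  ... | t , refl = t , refl

  onTopRow : ∀ {r} → Bub r → proj₁ r ≡ zero → ∃ λ t → topRow t ≡ r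
  onTopRow {_ , c} bub refl = fromℕ< c<k ,
    cong (zero ,_) (Fin.toℕ-injective (trans (toℕ-topRow _) (Fin.toℕ-fromℕ< c<k)))
    where c<k = bubble-top⁻¹ bub

  2k≡k+k : 2 * k ≡ k + k
  2k≡k+k = cong (k +_) (+-identityʳ k)

  ≤8⇒≤2k : ∀ {x} → x ≤ 8 → x ≤ 2 * k
  ≤8⇒≤2k x≤8 = ≤-trans x≤8 (*-monoʳ-≤ 2 4≤k)

  k+k≤2k : (k + 0) + (k + 0) ≤ 2 * k
  k+k≤2k = ≤-reflexive (cong (_+ (k + 0)) (+-identityʳ k))

  [1+k]+[k-1]≤2k : (suc k + 0) + (k ∸ 1 + 0) ≤ 2 * k
  [1+k]+[k-1]≤2k = ≤-reflexive (begin-equality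
    (suc k + 0) + (k ∸ 1 + 0)  ≡⟨ cong₂ _+_ (+-identityʳ (suc k)) (+-identityʳ (k ∸ 1)) ⟩
    suc k + (k ∸ 1)            ≡⟨ sym (+-suc k (k ∸ 1)) ⟩
    k + suc (k ∸ 1)            ≡⟨ cong (k +_) (m+[n∸m]≡n (≤-trans (s≤s z≤n) 4≤k)) ⟩
    k + k                      ≡⟨ sym 2k≡k+k ⟩
    2 * k                      ∎)
    where open ≤-Reasoning

  [k+2]+1≤2k : (k + 2) + (1 + 0) ≤ 2 * k
  [k+2]+1≤2k = begin
    (k + 2) + 1  ≡⟨ trans (+-assoc k 2 1) (+-comm k 3) ⟩
    3 + k        ≤⟨ +-monoˡ-≤ k (≤-trans (n≤1+n 3) 4≤k) ⟩
    k + k        ≡⟨ sym 2k≡k+k ⟩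
    2 * k        ∎
    where open ≤-Reasoning

  [1+k+2]+1≤2k : (suc k + 2) + (1 + 0) ≤ 2 * k
  [1+k+2]+1≤2k = begin
    suc ((k + 2) + 1)  ≡⟨ cong suc (trans (+-assoc k 2 1) (+-comm k 3)) ⟩
    4 + k              ≤⟨ +-monoˡ-≤ k 4≤k ⟩
    k + k              ≡⟨ sym 2k≡k+k ⟩
    2 * k              ∎
    where open ≤-Reasoning

  H? : ∀ r → Dec (InH r)
  H? r = T? (U (emb B r))

  ColumnPair : Fin W → Set
  ColumnPair j = ∃₂ λ i₁ i₂ → i₁ ≢ i₂ × InH (suc i₁ , j) × InH (suc i₂ , j)

  RowPair : Fin (suc k) → Set
  RowPair i = ∃₂ λ l₁ l₂ → l₁ ≢ l₂ × NotRight l₁ × NotRight l₂ × InH (suc i , l₁) × InH (suc i , l₂)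

  LowerColumnPair : Set
  LowerColumnPair = ∃ λ j → NotRight j × ColumnPair j

  PenultRow : Set
  PenultRow = ∃₂ λ i j → Inner j × InH (suc i , j) × InH (suc i , penult)

  columnPair? : ∀ j → Dec (ColumnPair j)
  columnPair? j = Fin.any? λ i₁ → Fin.any? λ i₂ → ¬? (i₁ Fin.≟ i₂) ×-dec H? _ ×-dec H? _

  rowPair? : ∀ i → Dec (RowPair i)
  rowPair? i = Fin.any? λ l₁ → Fin.any? λ l₂ →
    ¬? (l₁ Fin.≟ l₂) ×-dec toℕ l₁ ℕ.≤? k ×-dec toℕ l₂ ℕ.≤? k ×-dec H? _ ×-dec H? _

  ¬columnPair⇒unique : ∀ {j ρ₁ ρ₂} → ¬ ColumnPair j → ρ₁ ≢ zero → ρ₂ ≢ zero →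
                       InH (ρ₁ , j) → InH (ρ₂ , j) → ρ₁ ≡ ρ₂
  ¬columnPair⇒unique {ρ₁ = zero}   _ ρ₁≢0 _ = ⊥-elim (ρ₁≢0 refl)
  ¬columnPair⇒unique {ρ₂ = zero}   _ _ ρ₂≢0 = ⊥-elim (ρ₂≢0 refl)
  ¬columnPair⇒unique {ρ₁ = suc i₁} {suc i₂} ¬pair _ _ H₁ H₂ with i₁ Fin.≟ i₂
  ... | yes refl  = refl
  ... | no  i₁≢i₂ = ⊥-elim (¬pair (i₁ , i₂ , i₁≢i₂ , H₁ , H₂))

  ¬rowPair⇒unique : ∀ {i l₁ l₂} → ¬ RowPair i → NotRight l₁ → NotRight l₂ →
                    InH (suc i , l₁) → InH (suc i , l₂) → l₁ ≡ l₂
  ¬rowPair⇒unique {l₁ = l₁} {l₂} ¬pair l₁≤k l₂≤k H₁ H₂ with l₁ Fin.≟ l₂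
  ... | yes l₁≡l₂ = l₁≡l₂
  ... | no  l₁≢l₂ = ⊥-elim (¬pair (l₁ , l₂ , l₁≢l₂ , l₁≤k , l₂≤k , H₁ , H₂))

  ∣outside∣-lower : ∀ {i j} → NotRight j → ∣ outside (suc i , j) ∣ ≤ 0
  ∣outside∣-lower {i} j≤k = ∣outside∣-interior attached _ (interior {i} j≤k)

  columnPair-meets : ∀ {i₁ i₂ c} d → i₁ ≢ i₂ → NotRight c → c ≢ d →
                     InH (suc i₁ , c) → InH (suc i₂ , c) → InH (suc i₁ , d) ⊎ InH (suc i₂ , d)
  columnPair-meets {i₁} {i₂} {c} d i₁≢i₂ c≤k c≢d H₁ H₂ with H? (suc i₁ , d) | H? (suc i₂ , d)
  ... | yes H₁d | _       = inj₁ H₁d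
  ... | no _    | yes H₂d = inj₂ H₂d
  ... | no ¬H₁d | no ¬H₂d = ⊥-elim (noTwins (bounded⇒twins (suc i₁ , c) (suc i₂ , c) _ _
        (i₁≢i₂ ∘ Fin.suc-injective ∘ cong proj₁) H₁ H₂
        (alongRow i₁≢i₂ ¬H₁d) (∣outside∣-lower c≤k) (alongRow (i₁≢i₂ ∘ sym) ¬H₂d) (∣outside∣-lower c≤k)
        k+k≤2k))
    where
    alongRow : ∀ {i i′} → i ≢ i′ → ¬ InH (suc i , d) → ∣ privateIn (suc i , c) (suc i′ , c) ∣ ≤ k
    alongRow i≢i′ ¬Hd = privateIn-line _ _ (lowerRow _) (λ _ → _) (c ∷ d ∷ []) ((c≢d ∷ []) ∷ [] ∷ [])
      (onLowerRow ∘ proj₁ ∘ privateNbr-sameCol (i≢i′ ∘ Fin.suc-injective))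
      (λ nbr → proj₂ (privateNbr-sameCol (i≢i′ ∘ Fin.suc-injective) nbr)
             ∷ InH-≢ (inH nbr) ¬Hd ∘ cong (suc _ ,_) ∷ [])

  penultColumn-full : PenultRow → ∀ i′ → InH (suc i′ , penult)
  penultColumn-full (i , j , j<k , Hj , Hp) i′ with H? (suc i′ , penult)
  ... | yes H′ = H′
  ... | no ¬H′ = ⊥-elim (noTwins (bounded⇒twins (suc i , j) (suc i , penult) _ _ (j≢p ∘ cong proj₂) Hj Hp
        (privateIn-line _ _ (column j) (column-bubble j<k) (suc i ∷ []) ([] ∷ [])
          (onColumn ∘ proj₁ ∘ privateNbr-sameRow j≢p)
          (λ nbr → proj₂ (privateNbr-sameRow j≢p nbr) ∷ []))
        (∣outside∣-lower (inner⇒notRight j<k))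
        (privateIn-line _ _ (lowerColumn penult) (λ _ → _) (i ∷ i′ ∷ []) ((i≢i′ ∷ []) ∷ [] ∷ [])
          (λ nbr → onLowerColumn ¬inner-penult (bubble nbr) (proj₁ (privateNbr-sameRow (j≢p ∘ sym) nbr)))
          (λ nbr → proj₂ (privateNbr-sameRow (j≢p ∘ sym) nbr) ∘ cong suc
                 ∷ InH-≢ (inH nbr) ¬H′ ∘ cong (λ t → lowerColumn penult t) ∷ []))
        (∣outside∣-lower notRight-penult)
        [1+k]+[k-1]≤2k))
    where
    j≢p = inner⇒≢penult j<k
    i≢i′ : i ≢ i′
    i≢i′ refl = ¬H′ Hp

  alongLowerColumn : ∀ {i c d} → ¬ Inner c → c ≢ d → ∣ privateIn (suc i , c) (suc i , d) ∣ ≤ k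
  alongLowerColumn {i} {c} ¬inner c≢d = privateIn-line _ _ (lowerColumn c) (λ _ → _) (i ∷ []) ([] ∷ [])
    (λ nbr → onLowerColumn ¬inner (bubble nbr) (proj₁ (privateNbr-sameRow c≢d nbr)))
    (λ nbr → proj₂ (privateNbr-sameRow c≢d nbr) ∘ cong suc ∷ [])

  topFree-apart : ∀ {i j} → Inner j → NoOutsideNbrInH B U (zero , j) → InH (zero , j) → InH (suc i , j) → ⊥
  topFree-apart {i} {j} j<k free H₀ Hᵢ = noTwins (bounded⇒twins (suc i , j) (zero , j) _ (bubble-top j<k)
    (λ ()) Hᵢ H₀
    (privateIn-line _ (bubble-top j<k) (lowerRow i) (λ _ → _) (j ∷ []) ([] ∷ [])
      (onLowerRow ∘ proj₁ ∘ privateNbr-sameCol (λ ()))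
      (λ nbr → proj₂ (privateNbr-sameCol (λ ()) nbr) ∷ []))
    (∣outside∣-lower (inner⇒notRight j<k))
    (privateIn-line (bubble-top j<k) _ topRow topRow-bubble (t₀ ∷ []) ([] ∷ [])
      (λ nbr → onTopRow (bubble nbr) (proj₁ (privateNbr-sameCol (λ ()) nbr)))
      (λ nbr → (λ t≡t₀ → proj₂ (privateNbr-sameCol (λ ()) nbr) (cong proj₂ (trans (cong topRow t≡t₀) t₀↦j)))
             ∷ []))
    (∣outside∣-free free)
    [1+k]+[k-1]≤2k)
    where
    t₀ = proj₁ (onTopRow {zero , j} (bubble-top j<k) refl)
    t₀↦j = proj₂ (onTopRow {zero , j} (bubble-top j<k) refl)

  topMissing-apart : ∀ {i j} → Inner j → ¬ InH (zero , j) → InH (suc i , j) → InH (suc i , penult) → ⊥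
  topMissing-apart {i} {j} j<k ¬H₀ Hj Hp = noTwins (bounded⇒twins (suc i , j) (suc i , penult) _ _
    (j≢p ∘ cong proj₂) Hj Hp
    (privateIn-line _ _ (column j) (column-bubble j<k) (suc i ∷ zero ∷ []) (((λ ()) ∷ []) ∷ [] ∷ [])
      (onColumn ∘ proj₁ ∘ privateNbr-sameRow j≢p)
      (λ nbr → proj₂ (privateNbr-sameRow j≢p nbr) ∷ InH-≢ (inH nbr) ¬H₀ ∘ cong (column j) ∷ []))
    (∣outside∣-lower (inner⇒notRight j<k))
    (alongLowerColumn ¬inner-penult (j≢p ∘ sym))
    (∣outside∣-lower notRight-penult)
    k+k≤2k)
    where j≢p = inner⇒≢penult j<k

  ¬topRow-free : ∀ {j} → Inner j → NoOutsideNbrInH B U (zero , j) → (∀ i → InH (suc i , penult)) → ⊥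
  ¬topRow-free {j} j<k free full =
    [ meets , meets ]′ (columnPair-meets j zero≢last notRight-penult (inner⇒≢penult j<k ∘ sym) (full _) (full _))
    where
    zero≢last : zero ≢ fromℕ k
    zero≢last eq = <⇒≢ inner-zero (trans (cong toℕ eq) (Fin.toℕ-fromℕ k))
    meets : ∀ {i} → InH (suc i , j) → ⊥
    meets {i} Hj with H? (zero , j)
    ... | yes H₀ = topFree-apart j<k free H₀ Hj
    ... | no ¬H₀ = topMissing-apart j<k ¬H₀ Hj (full i)

  rightFree-apart : ∀ {i} → NoOutsideNbrInH B U (suc i , right) → InH (suc i , right) → InH (suc i , penult) → ⊥
  rightFree-apart {i} free Hr Hp = noTwins (bounded⇒twins (suc i , right) (suc i , penult) _ _
    (penult≢right ∘ sym ∘ cong proj₂) Hr Hp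
    (alongLowerColumn ¬inner-right (penult≢right ∘ sym)) (∣outside∣-free free)
    (alongLowerColumn ¬inner-penult penult≢right) (∣outside∣-lower notRight-penult)
    k+k≤2k)

  ¬rightPair-free : ∀ {i₁ i₂} → i₁ ≢ i₂ →
                    NoOutsideNbrInH B U (suc i₁ , right) → NoOutsideNbrInH B U (suc i₂ , right) →
                    (∀ i → InH (suc i , penult)) → ⊥
  ¬rightPair-free i₁≢i₂ free₁ free₂ full =
    [ (λ H₁ → rightFree-apart free₁ H₁ (full _)) , (λ H₂ → rightFree-apart free₂ H₂ (full _)) ]′
      (columnPair-meets right i₁≢i₂ notRight-penult penult≢right (full _) (full _))

  lowerColumnPair⇒penultRow : LowerColumnPair → PenultRow
  lowerColumnPair⇒penultRow (j , j≤k , i₁ , i₂ , i₁≢i₂ , H₁ , H₂) with notRight⇒inner⊎penult j≤k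
  ... | inj₁ j<k = [ (λ H₁p → i₁ , j , j<k , H₁ , H₁p) , (λ H₂p → i₂ , j , j<k , H₂ , H₂p) ]′
                     (columnPair-meets penult i₁≢i₂ j≤k (inner⇒≢penult j<k) H₁ H₂)
  ... | inj₂ refl = [ (λ H₁₀ → i₁ , zero , inner-zero , H₁₀ , H₁) ,
                      (λ H₂₀ → i₂ , zero , inner-zero , H₂₀ , H₂) ]′
                      (columnPair-meets zero i₁≢i₂ j≤k (inner⇒≢penult inner-zero ∘ sym) H₁ H₂)

  onlyTopInColumn : ∀ {i j l} → ¬ ColumnPair j → InH (suc i , j) → j ≢ l →
                    ∣ privateIn (suc i , j) (suc i , l) ∣ ≤ 1
  onlyTopInColumn {i} {j} {l} ¬pair Hj j≢l =
    privateIn-unique _ _ λ nbr₁ nbr₂ → trans (top nbr₁) (sym (top nbr₂))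
    where
    top : ∀ {ρ c} → PrivateNbr (suc i , j) (suc i , l) (ρ , c) → (ρ , c) ≡ (zero , j)
    top {zero} nbr with privateNbr-sameRow j≢l nbr
    ... | refl , _ = refl
    top {suc _} nbr with privateNbr-sameRow j≢l nbr
    ... | refl , ρ≢i = ⊥-elim (ρ≢i (¬columnPair⇒unique ¬pair (λ ()) (λ ()) (inH nbr) Hj))

  rowPair⇒lowerColumnPair : ∀ {i} → RowPair i → LowerColumnPair
  rowPair⇒lowerColumnPair {i} (j , l , j≢l , j≤k , l≤k , Hj , Hl) with columnPair? j | columnPair? l
  ... | yes pair | _        = j , j≤k , pair
  ... | no _     | yes pair = l , l≤k , pair
  ... | no ¬pj   | no ¬pl   = ⊥-elim (noTwins (bounded⇒twins (suc i , j) (suc i , l) _ _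
        (j≢l ∘ cong proj₂) Hj Hl
        (onlyTopInColumn ¬pj Hj j≢l) (∣outside∣-lower j≤k)
        (onlyTopInColumn ¬pl Hl (j≢l ∘ sym)) (∣outside∣-lower l≤k)
        (≤8⇒≤2k (m≤m+n 2 6))))

  rightRow⇒lowerColumnPair : ∀ {i j} → NotRight j → InH (suc i , j) → InH (suc i , right) → LowerColumnPair
  rightRow⇒lowerColumnPair {i} {j} j≤k Hj Hr with columnPair? j
  ... | yes pair = j , j≤k , pair
  ... | no ¬pair = ⊥-elim (noTwins (bounded⇒twins (suc i , right) (suc i , j) _ _
        (j≢r ∘ sym ∘ cong proj₂) Hr Hj
        (privateIn-line _ _ (lowerColumn right) (λ _ → _) [] []
          (λ nbr → onLowerColumn ¬inner-right (bubble nbr) (proj₁ (privateNbr-sameRow (j≢r ∘ sym) nbr)))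
          (λ _ → []))
        (∣outside∣≤2 attached _)
        (onlyTopInColumn ¬pair Hj j≢r) (∣outside∣-lower j≤k)
        [1+k+2]+1≤2k))
    where j≢r = notRight⇒≢right j≤k

  topColumn⇒lowerColumnPair : ∀ {i j} → Inner j → InH (zero , j) → InH (suc i , j) → LowerColumnPair
  topColumn⇒lowerColumnPair {i} {j} j<k H₀ Hj with rowPair? i
  ... | yes pair = rowPair⇒lowerColumnPair pair
  ... | no ¬pair = ⊥-elim (noTwins (bounded⇒twins (zero , j) (suc i , j) (bubble-top j<k) _
        (λ ()) H₀ Hj
        (privateIn-line (bubble-top j<k) _ topRow topRow-bubble [] []
          (λ nbr → onTopRow (bubble nbr) (proj₁ (privateNbr-sameCol (λ ()) nbr))) (λ _ → []))
        (∣outside∣≤2 attached (bubble-top j<k))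
        (privateIn-unique _ (bubble-top j<k) λ nbr₁ nbr₂ → trans (onlyRight nbr₁) (sym (onlyRight nbr₂)))
        (∣outside∣-lower (inner⇒notRight j<k))
        [k+2]+1≤2k))
    where
    onlyRight : ∀ {ρ c} → PrivateNbr (suc i , j) (zero , j) (ρ , c) → (ρ , c) ≡ (suc i , right)
    onlyRight {c = c} nbr with privateNbr-sameCol (λ ()) nbr
    ... | refl , c≢j with c Fin.≟ right
    ...   | yes refl = refl
    ...   | no  c≢r  =
      ⊥-elim (c≢j (¬rowPair⇒unique ¬pair (≢right⇒notRight c≢r) (inner⇒notRight j<k) (inH nbr) Hj))

  rightPair⇒lowerColumnPair : ∀ {i₁ i₂} → i₁ ≢ i₂ → InH (suc i₁ , right) → InH (suc i₂ , right) →
                              LowerColumnPair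
  rightPair⇒lowerColumnPair {i₁} {i₂} i₁≢i₂ H₁ H₂ with rowPair? i₁ | rowPair? i₂
  ... | yes pair | _        = rowPair⇒lowerColumnPair pair
  ... | no _     | yes pair = rowPair⇒lowerColumnPair pair
  ... | no ¬p₁   | no ¬p₂   = ⊥-elim (noTwins (bounded⇒twins (suc i₁ , right) (suc i₂ , right) _ _
        (i₁≢i₂ ∘ Fin.suc-injective ∘ cong proj₁) H₁ H₂
        (onlyOneInRow ¬p₁ i₁≢i₂) (∣outside∣≤2 attached _)
        (onlyOneInRow ¬p₂ (i₁≢i₂ ∘ sym)) (∣outside∣≤2 attached _)
        (≤8⇒≤2k (m≤m+n 6 2))))
    where
    onlyOneInRow : ∀ {i i′} → ¬ RowPair i → i ≢ i′ → ∣ privateIn (suc i , right) (suc i′ , right) ∣ ≤ 1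
    onlyOneInRow {i} ¬pair i≢i′ = privateIn-unique _ _ same
      where
      same : ∀ {ρ₁ c₁ ρ₂ c₂} → PrivateNbr (suc i , right) (suc _ , right) (ρ₁ , c₁) →
             PrivateNbr (suc i , right) (suc _ , right) (ρ₂ , c₂) → (ρ₁ , c₁) ≡ (ρ₂ , c₂)
      same nbr₁ nbr₂ with privateNbr-sameCol (i≢i′ ∘ Fin.suc-injective) nbr₁
                        | privateNbr-sameCol (i≢i′ ∘ Fin.suc-injective) nbr₂
      ... | refl , c₁≢r | refl , c₂≢r = cong (suc i ,_)
        (¬rowPair⇒unique ¬pair (≢right⇒notRight c₁≢r) (≢right⇒notRight c₂≢r) (inH nbr₁) (inH nbr₂))

  topPair⇒lowerColumnPair : ∀ {j l} → j ≢ l → Inner j → Inner l → InH (zero , j) → InH (zero , l) →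
                            LowerColumnPair
  topPair⇒lowerColumnPair {j} {l} j≢l j<k l<k Hj Hl with columnPair? j | columnPair? l
  ... | yes pair | _        = j , inner⇒notRight j<k , pair
  ... | no _     | yes pair = l , inner⇒notRight l<k , pair
  ... | no ¬pj   | no ¬pl   = ⊥-elim (noTwins (bounded⇒twins (zero , j) (zero , l)
        (bubble-top j<k) (bubble-top l<k) (j≢l ∘ cong proj₂) Hj Hl
        (onlyOneInColumn ¬pj j≢l j<k l<k) (∣outside∣≤2 attached (bubble-top j<k))
        (onlyOneInColumn ¬pl (j≢l ∘ sym) l<k j<k) (∣outside∣≤2 attached (bubble-top l<k))
        (≤8⇒≤2k (m≤m+n 6 2))))
    where
    onlyOneInColumn : ∀ {j l} → ¬ ColumnPair j → j ≢ l → Inner j → Inner l →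
                      ∣ privateIn (zero , j) (zero , l) ∣ ≤ 1
    onlyOneInColumn {j} {l} ¬pair j≢l j<k l<k = privateIn-unique (bubble-top j<k) (bubble-top l<k) same
      where
      same : ∀ {ρ₁ c₁ ρ₂ c₂} → PrivateNbr (zero , j) (zero , l) (ρ₁ , c₁) →
             PrivateNbr (zero , j) (zero , l) (ρ₂ , c₂) → (ρ₁ , c₁) ≡ (ρ₂ , c₂)
      same nbr₁ nbr₂ with privateNbr-sameRow j≢l nbr₁ | privateNbr-sameRow j≢l nbr₂
      ... | refl , ρ₁≢0 | refl , ρ₂≢0 =
        cong (_, j) (¬columnPair⇒unique ¬pair ρ₁≢0 ρ₂≢0 (inH nbr₁) (inH nbr₂))

  sameRow⇒lowerColumnPair : ∀ i {j l} → j ≢ l → Bub (i , j) → Bub (i , l) → InH (i , j) → InH (i , l) →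
                            LowerColumnPair
  sameRow⇒lowerColumnPair zero j≢l bj bl Hj Hl =
    topPair⇒lowerColumnPair j≢l (bubble-top⁻¹ bj) (bubble-top⁻¹ bl) Hj Hl
  sameRow⇒lowerColumnPair (suc i) {j} {l} j≢l _ _ Hj Hl with j Fin.≟ right | l Fin.≟ right
  ... | yes refl | yes refl = ⊥-elim (j≢l refl)
  ... | yes refl | no  l≢r  = rightRow⇒lowerColumnPair (≢right⇒notRight l≢r) Hl Hj
  ... | no  j≢r  | yes refl = rightRow⇒lowerColumnPair (≢right⇒notRight j≢r) Hj Hl
  ... | no  j≢r  | no  l≢r  =
    rowPair⇒lowerColumnPair (j , l , j≢l , ≢right⇒notRight j≢r , ≢right⇒notRight l≢r , Hj , Hl)

  sameColumn⇒lowerColumnPair : ∀ i i′ {j} → i ≢ i′ → Bub (i , j) → Bub (i′ , j) → InH (i , j) → InH (i′ , j) →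
                               LowerColumnPair
  sameColumn⇒lowerColumnPair zero    zero     i≢i′ _ _  _  _  = ⊥-elim (i≢i′ refl)
  sameColumn⇒lowerColumnPair zero    (suc i′) _    b₀ _ H₀ H′ = topColumn⇒lowerColumnPair (bubble-top⁻¹ b₀) H₀ H′
  sameColumn⇒lowerColumnPair (suc i) zero     _    _ b₀ H  H₀ = topColumn⇒lowerColumnPair (bubble-top⁻¹ b₀) H₀ H
  sameColumn⇒lowerColumnPair (suc i) (suc i′) {j} i≢i′ _ _ H H′ with j Fin.≟ right
  ... | yes refl = rightPair⇒lowerColumnPair (i≢i′ ∘ cong suc) H H′
  ... | no  j≢r  = j , ≢right⇒notRight j≢r , i , i′ , i≢i′ ∘ cong suc , H , H′

  adjacent⇒lowerColumnPair : ∀ {u v} → Bub u → Bub v → InH u → InH v → T (rookAdj u v) → LowerColumnPair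
  adjacent⇒lowerColumnPair {i , j} {i′ , l} bu bv Hu Hv adj
    with rookAdj⇒sameRow⊎sameCol {i = i} {j} {i′} {l} adj
  ... | inj₁ (refl , j≢l)  = sameRow⇒lowerColumnPair i j≢l bu bv Hu Hv
  ... | inj₂ (refl , i≢i′) = sameColumn⇒lowerColumnPair i i′ i≢i′ bu bv Hu Hv

  NeighbourInH : RookV W → Set
  NeighbourInH u = ∃₂ λ ρ c → Bub (ρ , c) × InH (ρ , c) × T (rookAdj u (ρ , c))

  neighbourInH? : ∀ u → Dec (NeighbourInH u)
  neighbourInH? u = Fin.any? λ ρ → Fin.any? λ c →
    T? (isBubble W (ρ , c)) ×-dec H? _ ×-dec T? (rookAdj u (ρ , c))

  distinct⇒lowerColumnPair : ∀ {u v} → Bub u → Bub v → u ≢ v → InH u → InH v → LowerColumnPair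
  distinct⇒lowerColumnPair {u} {v} bu bv u≢v Hu Hv with neighbourInH? u | neighbourInH? v
  ... | yes (_ , _ , br , Hr , adj) | _ = adjacent⇒lowerColumnPair bu br Hu Hr adj
  ... | no _ | yes (_ , _ , br , Hr , adj) = adjacent⇒lowerColumnPair bv br Hv Hr adj
  ... | no ¬nu | no ¬nv = ⊥-elim (noTwins (bounded⇒twins u v bu bv u≢v Hu Hv
        (privateIn-none bu bv λ nbr → ¬nu (_ , _ , bubble nbr , inH nbr , adj-u nbr)) (∣outside∣≤2 attached bu)
        (privateIn-none bv bu λ nbr → ¬nv (_ , _ , bubble nbr , inH nbr , adj-u nbr)) (∣outside∣≤2 attached bv)
        (≤8⇒≤2k (m≤m+n 4 4))))

  HasFreeBoundary : Set
  HasFreeBoundary =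
    (∃ λ p → T (isTopRow W p) × NoOutsideNbrInH B U p) ⊎
    (∃ λ p → ∃ λ q → p ≢ q × T (isRightCol W p) × T (isRightCol W q) ×
                     NoOutsideNbrInH B U p × NoOutsideNbrInH B U q)

  ¬freeBoundary : HasFreeBoundary → (∀ i → InH (suc i , penult)) → ⊥
  ¬freeBoundary (inj₁ ((ρ , c) , top , free)) full with topRow⁻¹ {ρ} {c} top
  ... | refl , j<k = ¬topRow-free j<k free full
  ¬freeBoundary (inj₂ ((ρ , c) , (ρ′ , c′) , p≢q , right-p , right-q , free-p , free-q)) full
    with rightCol⁻¹ {ρ} {c} right-p | rightCol⁻¹ {ρ′} {c′} right-q
  ... | _ , refl , refl | _ , refl , refl = ¬rightPair-free (p≢q ∘ cong (_, right) ∘ cong suc) free-p free-q full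

  ∣H∩B∣≤1 : HasFreeBoundary → count (λ x → U x ∧ inVB B x) ≤ 1
  ∣H∩B∣≤1 hyp = subst (_≤ 1) (sym (count≡∣∣ λ x → U x ∧ inVB B x)) (∣∣≤1 unique)
    where
    unique : ∀ x y → T (U x ∧ inVB B x) → T (U y ∧ inVB B y) → x ≡ y
    unique x y Hx Hy
      with x Fin.≟ y | inVB⇒emb {x} (proj₂ (T-∧⁻ (U x) Hx)) | inVB⇒emb {y} (proj₂ (T-∧⁻ (U y) Hy))
    ... | yes x≡y | _ | _ = x≡y
    ... | no  x≢y | r , br , refl | s , bs , refl = ⊥-elim (¬freeBoundary hyp (penultColumn-full
          (lowerColumnPair⇒penultRow (distinct⇒lowerColumnPair br bs (x≢y ∘ cong (emb B))
            (proj₁ (T-∧⁻ (U _) Hx)) (proj₁ (T-∧⁻ (U _) Hy))))))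

lemma5p3 : (d k : ℕ) → d ≡ 2 * k → 8 ≤ d →
    {n : ℕ} (G : Graph n) (B : BubbleIn G (k + 2)) → ProperlyAttached B →
    (U : Fin n → Bool) → Diverse G U d →
    ((∃ λ p → T (isTopRow (k + 2) p) × NoOutsideNbrInH B U p) ⊎
    (∃ λ p → ∃ λ q → p ≢ q × T (isRightCol (k + 2) p) × T (isRightCol (k + 2) q) ×
    NoOutsideNbrInH B U p × NoOutsideNbrInH B U q)) →
    count (λ x → U x ∧ inVB B x) ≤ 1
lemma5p3 .(2 * k) k refl 8≤2k G B attached U (_ , noTwins) hyp with k + 2 | +-comm k 2
... | .(2 + k) | refl =
  DiverseBubble.∣H∩B∣≤1 (*-cancelˡ-≤ 2 8≤2k) B attached U (λ {x} {y} → noTwins x y) hyp
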